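{- Let $\mathbb{K}$ be a field, $n \in \mathbb{N}$, $\lambda \in \mathbb{N}_0^n$, and let $G$ be a $\lambda$-lacunary subset of $\mathbb{K}[x_1,\ldots,x_n]$. Let $f \in \mathbb{K}[x_1,\ldots,x_n]$, and let $g \in G$, $\delta \in \mathbb{N}_0^n$ be such that $\mathrm{Lm}(x^\delta g)$ is a monomial of $f$. Let $x^\alpha$ be a $(G,\lambda)$-stable monomial in $f$, let $c \in \mathbb{K} \setminus \{0\}$, and let $h = f - c\, x^\delta g$. Then $x^\alpha$ is a $(G,\lambda)$-stable monomial in $h$.
   Context: Write $x^\alpha = x_1^{\alpha_1}\cdots x_n^{\alpha_n}$; $\operatorname{Mon}(f)$ is the set of monomials appearing in $f$ with nonzero coefficient, $\operatorname{Supp}(f)$ the set of their exponent vectors. For $\alpha,\beta \in \mathbb{N}_0^n$, $\alpha \sqsubseteq \beta$ means $\alpha_i \le \beta_i$ for all $i$. A polynomial $g$ is $\lambda$-lacunary ($\lambda \in \mathbb{N}_0^n$) if it contains a monomial $x^\mu$ such that for every $x^\nu \in \operatorname{Mon}(g)$ and every $i$, $\nu_i < \mu_i - \lambda_i$ or $\nu_i = \mu_i$; then $\nu \sqsubseteq \mu$ for all such $\nu$, and $\mathrm{Lm}(g) := x^\mu$ is the leading monomial of $g$ with respect to every admissible monomial ordering (a total order $\le_a$ on $\mathbb{N}_0^n$ with $\alpha \sqsubseteq \beta \Rightarrow \alpha \le_a \beta$ and $\alpha \le_a \beta \Rightarrow \alpha+\gamma \le_a \beta+\gamma$; $\mathrm{Lm}(p)$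 is the monomial of $p$ with $\le_a$-maximal exponent). A set $G$ is $\lambda$-lacunary if each element is. For $\alpha, \gamma, \lambda \in \mathbb{N}_0^n$ and $\lambda$-lacunary $G$, the monomial $x^\gamma$ is $(G,\lambda,\alpha)$-shading if: (i) $\alpha \sqsubseteq \gamma$ and $\alpha \neq \gamma$; (ii) for every $i$ with $\alpha_i < \gamma_i$ there is $g \in G$ with $\mathrm{Lm}(g) \mid x^\gamma$ and $\deg_{x_i}(g) > 0$; (iii) for every $i$ with $\alpha_i < \gamma_i$ we have $\alpha_i + \lambda_i < \gamma_i$. The monomial $x^\alpha$ is $(G,\lambda)$-stable in $f$ if: (i) $\alpha \in \operatorname{Supp}(f)$; (ii) there is no $g \in G$ with $\mathrm{Lm}(g) \mid x^\alpha$; (iii) no monomial in $\operatorname{Mon}(f)$ is $(G,\lambda,\alpha)$-shading. -}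

module Defs where

open import Level using (Level; _⊔_) renaming (suc to lsuc)
open import Algebra.Bundles using (CommutativeRing)
open import Data.Nat as ℕ using (ℕ; _+_; _<_; _≤_)
open import Data.Fin using (Fin)
open import Data.Vec using (Vec; lookup; zipWith)
open import Data.List using (List)
open import Data.List.Membership.Propositional using (_∈_; _∉_)
open import Data.Product using (Σ; Σ-syntax; ∃; _×_)
import Data.Product
open import Data.Sum using (_⊎_)
open import Relation.Binary.PropositionalEquality using (_≡_)
open import Relation.Nullary using (¬_; Dec; yes; no)
import Relation.Binary.PropositionalEquality as PE
open import Data.List.Membership.Propositional.Properties using (∈-map⁺; ∈-++⁺ˡ; ∈-++⁺ʳ)
open import Data.Vec using ([]; _∷_)
open import Data.Fin using (zero; suc)
open import Data.Nat.Properties using (m+[n∸m]≡n)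
import Data.List

record Field (c ℓ : Level) : Set (lsuc (c ⊔ ℓ)) where
  field
    commutativeRing : CommutativeRing c ℓ
  open CommutativeRing commutativeRing public
  field
    1≉0     : ¬ (1# ≈ 0#)
    inverse : ∀ x → ¬ (x ≈ 0#) → Σ[ y ∈ Carrier ] (x * y ≈ 1#)

Exp : ℕ → Set
Exp n = Vec ℕ n

-- α ⊑ β  (componentwise ≤), i.e. x^α ∣ x^β
_⊑_ : ∀ {n} → Exp n → Exp n → Set
α ⊑ β = ∀ i → lookup α i ≤ lookup β i

_⊕_ : ∀ {n} → Exp n → Exp n → Exp n
_⊕_ = zipWith _+_

_⊑?_ : ∀ {n} → (α β : Exp n) → Dec (α ⊑ β)
_⊑?_ {n} α β = go n α β
  where
  go : ∀ m → (α β : Exp m) → Dec (α ⊑ β)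
  go ℕ.zero [] [] = yes λ ()
  go (ℕ.suc m) (a ∷ α) (b ∷ β) with a ℕ.≤? b | go m α β
  ... | yes p | yes q = yes λ { zero → p ; (suc i) → q i }
  ... | no ¬p | _     = no λ h → ¬p (h zero)
  ... | _     | no ¬q = no λ h → ¬q (λ i → h (suc i))

⊕-∸ : ∀ {n} (δ β : Exp n) → δ ⊑ β → δ ⊕ zipWith ℕ._∸_ β δ ≡ β
⊕-∸ [] [] _ = PE.refl
⊕-∸ (d ∷ δ) (b ∷ β) h =
  PE.cong₂ _∷_ (m+[n∸m]≡n (h zero)) (⊕-∸ δ β (λ i → h (suc i)))

module _ {c ℓ : Level} (K : Field c ℓ) where
  open Field K

  record Poly (n : ℕ) : Set (c ⊔ ℓ) where
    field
      coeff    : Exp n → Carrier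
      support  : List (Exp n)
      finite   : ∀ α → α ∉ support → coeff α ≈ 0#
  open Poly public

  Supp : ∀ {n} → Poly n → Exp n → Set ℓ
  Supp f α = ¬ (coeff f α ≈ 0#)

  monMul : ∀ {n} → Exp n → Poly n → Poly n
  monMul {n} δ g = record
    { coeff   = cf
    ; support = Data.List.map (δ ⊕_) (support g)
    ; finite  = fin }
    where
    cf : Exp n → Carrier
    cf β with δ ⊑? β
    ... | yes _ = coeff g (zipWith ℕ._∸_ β δ)
    ... | no  _ = 0#
    fin : ∀ β → β ∉ Data.List.map (δ ⊕_) (support g) → cf β ≈ 0#
    fin β β∉ with δ ⊑? β
    ... | no _ = refl
    ... | yes d = finite g _ λ γ∈ →
                    β∉ (PE.subst (_∈ Data.List.map (δ ⊕_) (support g))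
                                 (⊕-∸ δ β d) (∈-map⁺ (δ ⊕_) γ∈))

  scale : ∀ {n} → Carrier → Poly n → Poly n
  scale a p = record
    { coeff = λ β → a * coeff p β ; support = support p
    ; finite = λ β β∉ → trans (*-congˡ (finite p β β∉)) (zeroʳ a) }

  _−ₚ_ : ∀ {n} → Poly n → Poly n → Poly n
  p −ₚ q = record
    { coeff = λ β → coeff p β - coeff q β
    ; support = support p Data.List.++ support q
    ; finite = λ β β∉ →
        trans (+-cong (finite p β (λ m → β∉ (∈-++⁺ˡ m)))
                      (-‿cong (finite q β (λ m → β∉ (∈-++⁺ʳ (support p) m)))))
              (trans (+-congˡ RP.-0#≈0#) (+-identityʳ 0#)) }
    where import Algebra.Properties.Ring ring as RP

  -- μ witnesses that g is λ-lacunary: x^μ ∈ Mon(g) and for every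
  -- x^ν ∈ Mon(g) and every i:  ν_i < μ_i − λ_i  (i.e. ν_i + λ_i < μ_i)  or  ν_i = μ_i.
  LacWitness : ∀ {n} → Exp n → Poly n → Exp n → Set ℓ
  LacWitness λ' g μ =
    Supp g μ ×
    (∀ ν → Supp g ν → ∀ i →
       (lookup ν i ℕ.+ lookup λ' i < lookup μ i) ⊎ (lookup ν i ≡ lookup μ i))

  IsLacunary : ∀ {n} → Exp n → Poly n → Set ℓ
  IsLacunary λ' g = Σ[ μ ∈ Exp _ ] LacWitness λ' g μ

  LacunarySet : ∀ {n p} → Exp n → (Poly n → Set p) → Set (c ⊔ ℓ ⊔ p)
  LacunarySet λ' G = ∀ g → G g → IsLacunary λ' g

  -- Exponent of Lm(g) for a λ-lacunary g (the witness μ, which is unique).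
  Lm : ∀ {n} {λ' : Exp n} (g : Poly n) → IsLacunary λ' g → Exp n
  Lm g l = Data.Product.proj₁ l

  -- x^μ is the leading monomial of p w.r.t. every admissible ordering,
  -- witnessed by: x^μ ∈ Mon(p) and ν ⊑ μ for every x^ν ∈ Mon(p).
  IsLeading : ∀ {n} → Poly n → Exp n → Set (ℓ)
  IsLeading p μ = Supp p μ × (∀ ν → Supp p ν → ν ⊑ μ)

  DegPos : ∀ {n} → Poly n → Fin n → Set ℓ
  DegPos g i = Σ[ ν ∈ Exp _ ] (Supp g ν × 0 < lookup ν i)

  Shading : ∀ {n p} (λ' : Exp n) (G : Poly n → Set p) → LacunarySet λ' G →
            Exp n → Exp n → Set (c ⊔ ℓ ⊔ p)
  Shading λ' G lac α γ =
    (α ⊑ γ) × ¬ (α ≡ γ) ×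
    (∀ i → lookup α i < lookup γ i →
       Σ[ g ∈ Poly _ ] Σ[ gG ∈ G g ] ((Lm {λ' = λ'} g (lac g gG) ⊑ γ) × DegPos g i)) ×
    (∀ i → lookup α i < lookup γ i → lookup α i ℕ.+ lookup λ' i < lookup γ i)

  Stable : ∀ {n p} (λ' : Exp n) (G : Poly n → Set p) → LacunarySet λ' G →
           Poly n → Exp n → Set (c ⊔ ℓ ⊔ p)
  Stable λ' G lac f α =
    Supp f α ×
    ¬ (Σ[ g ∈ Poly _ ] Σ[ gG ∈ G g ] (Lm {λ' = λ'} g (lac g gG) ⊑ α)) ×
    (∀ γ → Supp f γ → ¬ Shading λ' G lac α γ)

{-# OPTIONS --safe #-}

-- If some x^β of x^δ g satisfies the shading conditions for α (possibly with β = α),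
-- then so does Lm(x^δ g) = x^δ Lm(g): in each coordinate, lacunarity of g either
-- puts β level with Lm(x^δ g), so the conditions carry over, or leaves a gap larger
-- than λ below it, which g itself covers.  Since Lm(g) does not divide x^α, this makes
-- Lm(x^δ g) a shading monomial of f, contradicting stability.  So x^α is not a monomial
-- of x^δ g and no monomial of x^δ g shades it: subtracting c x^δ g from f neither
-- removes x^α nor adds a shading monomial.

module Submission where

open import Defs
open import Level using (Level; _⊔_)
open import Data.Nat using (ℕ; _≤_; _<_; _+_; _∸_)
open import Data.Nat.Properties
  using (≤-refl; ≤-trans; ≤-antisym; <-irrefl; <⇒≤; m≤m+n; m≤n+m; m+n∸m≡n;
         m<n⇒0<n; +-assoc; +-monoˡ-≤; +-monoʳ-≤; +-monoʳ-<; module ≤-Reasoning)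
open import Data.Fin using (Fin)
open import Data.Vec using (lookup; zipWith; []; _∷_)
open import Data.Vec.Properties using (lookup-zipWith)
open import Data.Vec.Relation.Binary.Pointwise.Extensional using (ext; Pointwise-≡⇒≡)
open import Data.Product using (Σ-syntax; ∃-syntax; _×_; _,_; proj₁; proj₂)
open import Data.Sum using (inj₁; inj₂)
open import Data.Empty using (⊥-elim)
open import Relation.Nullary using (¬_; yes; no)
open import Relation.Binary.PropositionalEquality as ≡ using (_≡_; cong₂; subst; subst₂)

+-shift-< : ∀ {a b d l m} → a ≤ d + b → b + l < m → a + l < d + m
+-shift-< {a} {b} {d} {l} {m} a≤d+b b+l<m = begin-strict
  a + l        ≤⟨ +-monoˡ-≤ l a≤d+b ⟩
  d + b + l    ≡⟨ +-assoc d b l ⟩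
  d + (b + l)  <⟨ +-monoʳ-< d b+l<m ⟩
  d + m        ∎
  where open ≤-Reasoning

⊕-∸-cancelˡ : ∀ {n} (δ ν : Exp n) → zipWith _∸_ (δ ⊕ ν) δ ≡ ν
⊕-∸-cancelˡ []      []      = ≡.refl
⊕-∸-cancelˡ (d ∷ δ) (x ∷ ν) = cong₂ _∷_ (m+n∸m≡n d x) (⊕-∸-cancelˡ δ ν)

module _ {n : ℕ} where

  lookup-⊕ : (α β : Exp n) (i : Fin n) →
             lookup (α ⊕ β) i ≡ lookup α i + lookup β i
  lookup-⊕ α β i = lookup-zipWith _+_ i α β

  ⊑-antisym : {α β : Exp n} → α ⊑ β → β ⊑ α → α ≡ β
  ⊑-antisym α⊑β β⊑α = Pointwise-≡⇒≡ (ext λ i → ≤-antisym (α⊑β i) (β⊑α i))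

  α⊑α⊕β : (α β : Exp n) → α ⊑ (α ⊕ β)
  α⊑α⊕β α β i = subst (lookup α i ≤_) (≡.sym (lookup-⊕ α β i)) (m≤m+n _ _)

  β⊑α⊕β : (α β : Exp n) → β ⊑ (α ⊕ β)
  β⊑α⊕β α β i = subst (lookup β i ≤_) (≡.sym (lookup-⊕ α β i)) (m≤n+m _ _)

  ⊕-monoʳ-⊑ : (δ : Exp n) {α β : Exp n} → α ⊑ β → (δ ⊕ α) ⊑ (δ ⊕ β)
  ⊕-monoʳ-⊑ δ {α} {β} α⊑β i =
    subst₂ _≤_ (≡.sym (lookup-⊕ δ α i)) (≡.sym (lookup-⊕ δ β i))
               (+-monoʳ-≤ (lookup δ i) (α⊑β i))

module _ {c ℓ : Level} (K : Field c ℓ) {n : ℕ} where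
  open Field K
  open import Algebra.Properties.Ring ring using (-0#≈0#)

  Supp-monMul⁺ : (δ : Exp n) (g : Poly K n) {ν : Exp n} →
                 Supp K g ν → Supp K (monMul K δ g) (δ ⊕ ν)
  Supp-monMul⁺ δ g {ν} gν with δ ⊑? (δ ⊕ ν)
  ... | yes _  = subst (Supp K g) (≡.sym (⊕-∸-cancelˡ δ ν)) gν
  ... | no δ⋢ = ⊥-elim (δ⋢ (α⊑α⊕β δ ν))

  Supp-monMul⁻ : (δ : Exp n) (g : Poly K n) {β : Exp n} →
                 Supp K (monMul K δ g) β → ∃[ ν ] (Supp K g ν × δ ⊕ ν ≡ β)
  Supp-monMul⁻ δ g {β} mβ with δ ⊑? β
  ... | yes δ⊑β = zipWith _∸_ β δ , mβ , ⊕-∸ δ β δ⊑β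
  ... | no _    = ⊥-elim (mβ refl)

  LacWitness⇒⊑ : {λ' μ : Exp n} (g : Poly K n) → LacWitness K λ' g μ →
                 {ν : Exp n} → Supp K g ν → ν ⊑ μ
  LacWitness⇒⊑ _ (_ , gap-or-level) {ν} gν i with gap-or-level ν gν i
  ... | inj₁ gap   = ≤-trans (m≤m+n _ _) (<⇒≤ gap)
  ... | inj₂ level = subst (_≤ _) (≡.sym level) ≤-refl

  IsLeading-monMul : {λ' μ μg : Exp n} (δ : Exp n) (g : Poly K n) →
                     IsLeading K (monMul K δ g) μ → LacWitness K λ' g μg →
                     μ ≡ δ ⊕ μg
  IsLeading-monMul {λ'} δ g (mμ , below) w@(gμg , _) with Supp-monMul⁻ δ g mμ
  ... | ν , gν , ≡.refl =
    ⊑-antisym (⊕-monoʳ-⊑ δ (LacWitness⇒⊑ {λ'} g w gν)) (below _ (Supp-monMul⁺ δ g gμg))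

  module _ (a : Carrier) (f m : Poly K n) where

    coeff-−ₚ-scale : {γ : Exp n} → coeff m γ ≈ 0# →
                     coeff (_−ₚ_ K f (scale K a m)) γ ≈ coeff f γ
    coeff-−ₚ-scale {γ} m≈0 =
      trans (+-congˡ (-‿cong (trans (*-congˡ m≈0) (zeroʳ a))))
            (trans (+-congˡ -0#≈0#) (+-identityʳ (coeff f γ)))

    Supp-−ₚ-scale⁺ : {γ : Exp n} → Supp K f γ → ¬ Supp K m γ →
                     Supp K (_−ₚ_ K f (scale K a m)) γ
    Supp-−ₚ-scale⁺ fγ m∌γ h≈0 = m∌γ λ m≈0 → fγ (trans (sym (coeff-−ₚ-scale m≈0)) h≈0)

    ¬Supp-−ₚ-scale : {γ : Exp n} → ¬ Supp K f γ → ¬ Supp K m γ →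
                     ¬ Supp K (_−ₚ_ K f (scale K a m)) γ
    ¬Supp-−ₚ-scale f∌γ m∌γ hγ =
      f∌γ λ f≈0 → m∌γ λ m≈0 → hγ (trans (coeff-−ₚ-scale m≈0) f≈0)

module _ {c ℓ p : Level} (K : Field c ℓ) {n : ℕ} (λ' : Exp n)
         (G : Poly K n → Set p) (lac : LacunarySet K λ' G) where

  record ShadedAt (α γ : Exp n) (i : Fin n) : Set (c ⊔ ℓ ⊔ p) where
    constructor shadedAt
    field
      covered : Σ[ g ∈ Poly K n ] Σ[ gG ∈ G g ]
                  ((Lm K {λ' = λ'} g (lac g gG) ⊑ γ) × DegPos K g i)
      spaced  : lookup α i + lookup λ' i < lookup γ i

  WeaklyShading : Exp n → Exp n → Set (c ⊔ ℓ ⊔ p)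
  WeaklyShading α γ = α ⊑ γ × (∀ i → lookup α i < lookup γ i → ShadedAt α γ i)

  WeaklyShading-refl : (α : Exp n) → WeaklyShading α α
  WeaklyShading-refl α = (λ _ → ≤-refl) , λ i α<α → ⊥-elim (<-irrefl ≡.refl α<α)

  Shading⇒WeaklyShading : {α γ : Exp n} → Shading K λ' G lac α γ → WeaklyShading α γ
  Shading⇒WeaklyShading (α⊑γ , _ , covered , spaced) =
    α⊑γ , λ i α<γ → shadedAt (covered i α<γ) (spaced i α<γ)

  WeaklyShading⇒Shading : {α γ : Exp n} → ¬ α ≡ γ → WeaklyShading α γ →
                          Shading K λ' G lac α γ
  WeaklyShading⇒Shading α≢γ (α⊑γ , shaded) =
    α⊑γ , α≢γ , (λ i α<γ → ShadedAt.covered (shaded i α<γ))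
              , (λ i α<γ → ShadedAt.spaced (shaded i α<γ))

  ShadedAt-mono : {α β γ : Exp n} {i : Fin n} → β ⊑ γ → lookup β i ≡ lookup γ i →
                  ShadedAt α β i → ShadedAt α γ i
  ShadedAt-mono β⊑γ level (shadedAt (g , gG , Lm⊑β , deg) spaced) =
    shadedAt (g , gG , (λ j → ≤-trans (Lm⊑β j) (β⊑γ j)) , deg)
             (subst (_ <_) level spaced)

  module _ {g : Poly K n} (gG : G g) (δ : Exp n) where
    private
      μg : Exp n
      μg = Lm K {λ' = λ'} g (lac g gG)

      lacunary : LacWitness K λ' g μg
      lacunary = proj₂ (lac g gG)

      ⊕-⊑-Lm : {ν : Exp n} → Supp K g ν → (δ ⊕ ν) ⊑ (δ ⊕ μg)
      ⊕-⊑-Lm gν = ⊕-monoʳ-⊑ δ (LacWitness⇒⊑ K {λ' = λ'} g lacunary gν)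

    ShadedAt-lift : {α ν : Exp n} → Supp K g ν → (i : Fin n) →
                    lookup α i ≤ lookup (δ ⊕ ν) i →
                    (lookup α i < lookup (δ ⊕ ν) i → ShadedAt α (δ ⊕ ν) i) →
                    lookup α i < lookup (δ ⊕ μg) i → ShadedAt α (δ ⊕ μg) i
    ShadedAt-lift {α} {ν} gν i α≤β shadedβ α<μ with proj₂ lacunary ν gν i
    ... | inj₁ gap =
      shadedAt (g , gG , β⊑α⊕β δ μg , μg , proj₁ lacunary , m<n⇒0<n gap) spaced
      where
      spaced : lookup α i + lookup λ' i < lookup (δ ⊕ μg) i
      spaced = subst (_ <_) (≡.sym (lookup-⊕ δ μg i))
                 (+-shift-< (subst (_ ≤_) (lookup-⊕ δ ν i) α≤β) gap)
    ... | inj₂ level =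
      ShadedAt-mono (⊕-⊑-Lm gν) β≡μ (shadedβ (subst (_ <_) (≡.sym β≡μ) α<μ))
      where
      β≡μ : lookup (δ ⊕ ν) i ≡ lookup (δ ⊕ μg) i
      β≡μ = ≡.trans (lookup-⊕ δ ν i)
                    (≡.trans (≡.cong (lookup δ i +_) level) (≡.sym (lookup-⊕ δ μg i)))

    WeaklyShading-Lm : {α β : Exp n} → Supp K (monMul K δ g) β →
                       WeaklyShading α β → WeaklyShading α (δ ⊕ μg)
    WeaklyShading-Lm mβ with Supp-monMul⁻ K δ g mβ
    ... | ν , gν , ≡.refl = λ (α⊑β , shaded) →
      (λ i → ≤-trans (α⊑β i) (⊕-⊑-Lm gν i)) , λ i → ShadedAt-lift gν i (α⊑β i) (shaded i)

  Stable⇒¬WeaklyShading-monMul :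
    {f g : Poly K n} → G g → (δ : Exp n) {μ α β : Exp n} →
    IsLeading K (monMul K δ g) μ → Supp K f μ → Stable K λ' G lac f α →
    Supp K (monMul K δ g) β → ¬ WeaklyShading α β
  Stable⇒¬WeaklyShading-monMul {f} {g} gG δ {μ} {α} lead fμ (_ , undivided , unshaded)
                               mβ αβ =
    unshaded _ (subst (Supp K f) μ≡δ⊕Lm fμ)
      (WeaklyShading⇒Shading α≢δ⊕Lm (WeaklyShading-Lm gG δ mβ αβ))
    where
    μ≡δ⊕Lm : μ ≡ δ ⊕ Lm K {λ' = λ'} g (lac g gG)
    μ≡δ⊕Lm = IsLeading-monMul K {λ' = λ'} δ g lead (proj₂ (lac g gG))
    α≢δ⊕Lm : ¬ α ≡ δ ⊕ Lm K {λ' = λ'} g (lac g gG)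
    α≢δ⊕Lm ≡.refl = undivided (g , gG , β⊑α⊕β δ _)

theorem4p4 : ∀ {c ℓ p : Level} (K : Field c ℓ) (n : ℕ) → 1 ≤ n →
    (λ' : Exp n) (G : Poly K n → Set p) (lac : LacunarySet K λ' G) →
    (f g : Poly K n) → G g → (δ : Exp n) →
    (Σ[ μ ∈ Exp n ] (IsLeading K (monMul K δ g) μ × Supp K f μ)) →
    (α : Exp n) → Stable K λ' G lac f α →
    (cst : Field.Carrier K) → ¬ (Field._≈_ K cst (Field.0# K)) →
    Stable K λ' G lac (_−ₚ_ K f (scale K cst (monMul K δ g))) α
theorem4p4 K n _ λ' G lac f g gG δ (_ , lead , fμ) α stable@(fα , undivided , unshaded)
           cst _ =
  Supp-−ₚ-scale⁺ K cst f m fα (λ mα → excluded mα (WeaklyShading-refl K λ' G lac α)) ,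
  undivided ,
  λ γ hγ αγ → ¬Supp-−ₚ-scale K cst f m (λ fγ → unshaded γ fγ αγ)
                (λ mγ → excluded mγ (Shading⇒WeaklyShading K λ' G lac αγ)) hγ
  where
  m : Poly K n
  m = monMul K δ g

  excluded : {β : Exp n} → Supp K m β → ¬ WeaklyShading K λ' G lac α β
  excluded = Stable⇒¬WeaklyShading-monMul K λ' G lac {f = f} gG δ lead fμ stable
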